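{- Let $(\mathcal{U},\mathcal{V})$ be a factorization of a projective space $\mathbb{G}$ such that $\mathcal{U}$ is not full-rank. Then $(\mathcal{U},\langle\!\langle\mathcal{U}\rangle\!\rangle\cap\mathcal{V})$ is a factorization of the projective space $\langle\!\langle\mathcal{U}\rangle\!\rangle$.
   Context: For points of a projective space, $\langle\!\langle\cdot\rangle\!\rangle$ denotes the smallest projective subspace containing them (so $\langle\!\langle u,v\rangle\!\rangle$ is the line through $u\neq v$). Two disjoint sets $\mathcal{U},\mathcal{V}$ of points form a factorization $(\mathcal{U},\mathcal{V})$ of a projective space if for every point $x\notin\mathcal{U}\cup\mathcal{V}$ there are unique points $u\in\mathcal{U}$, $v\in\mathcal{V}$ with $x\in\langle\!\langle u,v\rangle\!\rangle$. A set $\mathcal{U}$ of points is full-rank if $\langle\!\langle\mathcal{U}\rangle\!\rangle$ is the whole space. -}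

module Defs where

open import Level using (Level; suc)
open import Data.Product using (Σ; Σ-syntax; ∃; _×_; _,_)
open import Data.Empty using (⊥)
open import Data.Unit.Polymorphic using (⊤)
open import Relation.Nullary using (¬_)
open import Relation.Binary.PropositionalEquality using (_≡_; _≢_)
open import Function.Bundles using (_⇔_)

-- A projective space in the sense of Veblen–Young, presented as a set of
-- points together with the incidence relation  OnLine x y z :
-- "z lies on ⟨⟨x,y⟩⟩"  (the line through x and y when x ≢ y, and the
-- singleton {x} when x ≡ y, i.e. ⟨⟨x,y⟩⟩ is the flat hull of {x,y}).
record ProjectiveSpace (ℓ : Level) : Set (suc ℓ) where
  field
    Point  : Set ℓ
    OnLine : Point → Point → Point → Set ℓ
    on-left  : ∀ x y → OnLine x y x
    on-right : ∀ x y → OnLine x y y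
    on-same  : ∀ x z → OnLine x x z → z ≡ x
    line-unique : ∀ x y z w → x ≢ y → z ≢ w → OnLine x y z → OnLine x y w →
                  ∀ p → (OnLine x y p ⇔ OnLine z w p)
    three-points : ∀ x y → x ≢ y →
                   Σ[ z ∈ Point ] (OnLine x y z × z ≢ x × z ≢ y)
    veblen : ∀ a b c d p → a ≢ c → b ≢ d → OnLine a b p → OnLine c d p →
             Σ[ q ∈ Point ] (OnLine a c q × OnLine b d q)

module _ {ℓ : Level} (G : ProjectiveSpace ℓ) where
  open ProjectiveSpace G

  PointSet : Set (suc ℓ)
  PointSet = Point → Set ℓ

  -- ⟨⟨ U ⟩⟩ : the smallest projective subspace (= set closed under
  -- ⟨⟨x,y⟩⟩) containing U, given as the inductive closure.
  data Span (U : PointSet) : Point → Set ℓ where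
    base : ∀ {x} → U x → Span U x
    join : ∀ {x y z} → Span U x → Span U y → OnLine x y z → Span U z

  FullRank : PointSet → Set ℓ
  FullRank U = ∀ x → Span U x

  _∩_ : PointSet → PointSet → PointSet
  (A ∩ B) x = A x × B x

  -- (U , V) is a factorization of the projective subspace S (with its
  -- induced lines ⟨⟨u,v⟩⟩ ∩ S = ⟨⟨u,v⟩⟩ for u, v ∈ S).
  record FactorizationIn (S U V : PointSet) : Set ℓ where
    field
      U⊆S      : ∀ x → U x → S x
      V⊆S      : ∀ x → V x → S x
      disjoint : ∀ x → U x → V x → ⊥
      exists   : ∀ x → S x → ¬ U x → ¬ V x →
                 Σ[ u ∈ Point ] Σ[ v ∈ Point ] (U u × V v × OnLine u v x)
      unique   : ∀ x → S x → ¬ U x → ¬ V x →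
                 ∀ u v u′ v′ → U u → V v → OnLine u v x →
                 U u′ → V v′ → OnLine u′ v′ x → (u ≡ u′ × v ≡ v′)

  Factorization : PointSet → PointSet → Set ℓ
  Factorization U V = FactorizationIn (λ _ → ⊤) U V

{-# OPTIONS --safe #-}
module Submission where

-- If x ∉ U lies on the line through u ∈ U and v ∈ V, then that line is also
-- the line through u and x, so v lies on ⟨⟨u,x⟩⟩ ⊆ ⟨⟨U⟩⟩ whenever x ∈ ⟨⟨U⟩⟩.
-- Hence the factorization of a point x of ⟨⟨U⟩⟩ already uses a point of
-- ⟨⟨U⟩⟩ ∩ V, and uniqueness is inherited from the factorization of G.

open import Defs
open import Level using (Level)
open import Data.Product using (Σ-syntax; _×_; _,_; proj₁; proj₂)
open import Relation.Nullary using (¬_)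
open import Relation.Binary.PropositionalEquality using (_≢_; refl)
open import Function.Bundles using (Equivalence)

module _ {ℓ : Level} (G : ProjectiveSpace ℓ) where
  open ProjectiveSpace G

  on-line-swap : ∀ {u v x} → u ≢ v → u ≢ x → OnLine u v x → OnLine u x v
  on-line-swap {u} {v} {x} u≢v u≢x uvx =
    Equivalence.to (line-unique u v u x u≢v u≢x (on-left u v) uvx v) (on-right u v)

  span-on-line : ∀ {U u x v} → U u → Span G U x → u ≢ x → u ≢ v →
                 OnLine u v x → Span G U v
  span-on-line Uu Sx u≢x u≢v uvx = join (base Uu) Sx (on-line-swap u≢v u≢x uvx)

  module _ {U V : PointSet G} (F : Factorization G U V) where
    open FactorizationIn F

    factor-in-span : ∀ x → Span G U x → ¬ U x → ¬ _∩_ G (Span G U) V x →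
                     Σ[ u ∈ Point ] Σ[ v ∈ Point ]
                       (U u × _∩_ G (Span G U) V v × OnLine u v x)
    factor-in-span x Sx ¬Ux ¬SVx with exists x _ ¬Ux (λ Vx → ¬SVx (Sx , Vx))
    ... | u , v , Uu , Vv , uvx =
      u , v , Uu , (span-on-line Uu Sx u≢x u≢v uvx , Vv) , uvx
      where
      u≢x : u ≢ x
      u≢x refl = ¬Ux Uu
      u≢v : u ≢ v
      u≢v refl = disjoint u Uu Vv

proposition3 : ∀ {ℓ : Level} (G : ProjectiveSpace ℓ) (U V : PointSet G) →
               Factorization G U V → ¬ FullRank G U →
               FactorizationIn G (Span G U) U (_∩_ G (Span G U) V)
proposition3 G U V F _ = record
  { U⊆S      = λ _ → base
  ; V⊆S      = λ _ → proj₁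
  ; disjoint = λ x Ux SVx → disjoint x Ux (proj₂ SVx)
  ; exists   = factor-in-span G F
  ; unique   = λ x Sx ¬Ux ¬SVx u v u′ v′ Uu SVv uvx Uu′ SVv′ u′v′x →
      unique x _ ¬Ux (λ Vx → ¬SVx (Sx , Vx))
             u v u′ v′ Uu (proj₂ SVv) uvx Uu′ (proj₂ SVv′) u′v′x
  }
  where open FactorizationIn F
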